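{- Let $(T_n)_{n\in\mathbb{N}}$ be an $\mathbb{N}$-indexed family of closeness spaces with closeness functions $c_n$. Then $\prod_{n\in\mathbb{N}}T_n$ equipped with the countable product closeness function $c_{\Pi T}$ is a closeness space.
   Context: Constructive type theory with function extensionality. $\mathbb{N}_\infty$: decreasing binary sequences $u:\mathbb{N}\to\{0,1\}$; $\infty$: the constant $1$ sequence; $u\preceq v$ iff $\forall n\,(u_n=1\Rightarrow v_n=1)$; $\min(u,v)$ pointwise. A closeness space is a type $X$ with $c:X\to X\to\mathbb{N}_\infty$ such that (i) $c(x,y)=\infty\iff x=y$, (ii) $c(x,y)=c(y,x)$, (iii) $\min(c(x,y),c(y,z))\preceq c(x,z)$. The countable product closeness function is defined by $c_{\Pi T}(\alpha,\beta)_0:=c_0(\alpha_0,\beta_0)_0$ and $c_{\Pi T}(\alpha,\beta)_{m+1}:=\min(c_0(\alpha_0,\beta_0)_{m+1},\ c_{\Pi(\mathrm{tail}\,T)}(\mathrm{tail}\,\alpha,\mathrm{tail}\,\beta)_m)$, where $\mathrm{tail}\,T=(T_{n+1})_n$ with closeness functions $(c_{n+1})_n$ and $\mathrm{tail}\,\alpha=(\alpha_{n+1})_n$; equivalently $c_{\Pi T}(\alpha,\beta)_m=\min_{i\le m}c_i(\alpha_i,\beta_i)_{m-i}$. -}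

module Defs where

open import Data.Nat using (ℕ; zero; suc)
open import Data.Bool using (Bool; true; false; _∧_)
open import Data.Product using (Σ; _×_; _,_; proj₁; proj₂)
open import Relation.Binary.PropositionalEquality using (_≡_)
open import Function.Bundles using (_⇔_)
open import Level using (Level; _⊔_)

-- binary sequences are ℕ → Bool (true = 1, false = 0)
is-decreasing : (ℕ → Bool) → Set
is-decreasing u = (n : ℕ) → u (suc n) ≡ true → u n ≡ true

ℕ∞ : Set
ℕ∞ = Σ (ℕ → Bool) is-decreasing

ι : ℕ∞ → ℕ → Bool
ι = proj₁

∞ : ℕ∞
∞ = (λ _ → true) , (λ _ _ → _≡_.refl)

_≼_ : ℕ∞ → ℕ∞ → Set
u ≼ v = (n : ℕ) → ι u n ≡ true → ι v n ≡ true

∧-decr : {u v : ℕ → Bool} → is-decreasing u → is-decreasing v → is-decreasing (λ n → u n ∧ v n)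
∧-decr {u} {v} du dv n p with u (suc n) | v (suc n) | du n | dv n
... | true | true | f | g rewrite f _≡_.refl | g _≡_.refl = _≡_.refl
∧-decr {u} {v} du dv n () | true | false | f | g
∧-decr {u} {v} du dv n () | false | _ | f | g

min : ℕ∞ → ℕ∞ → ℕ∞
min (u , du) (v , dv) = (λ n → u n ∧ v n) , ∧-decr du dv

record IsClosenessSpace {ℓ : Level} (X : Set ℓ) (c : X → X → ℕ∞) : Set ℓ where
  field
    c-∞     : (x y : X) → (c x y ≡ ∞) ⇔ (x ≡ y)
    c-sym   : (x y : X) → c x y ≡ c y x
    c-ultra : (x y z : X) → min (c x y) (c y z) ≼ c x z

ClosenessSpace : (ℓ : Level) → Set (Level.suc ℓ)
ClosenessSpace ℓ = Σ (Set ℓ) λ X → Σ (X → X → ℕ∞) λ c → IsClosenessSpace X c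

Π-type : {ℓ : Level} → (ℕ → ClosenessSpace ℓ) → Set ℓ
Π-type T = (n : ℕ) → proj₁ (T n)

tailᵀ : {ℓ : Level} → (ℕ → ClosenessSpace ℓ) → (ℕ → ClosenessSpace ℓ)
tailᵀ T n = T (suc n)

tail : {ℓ : Level} {T : ℕ → ClosenessSpace ℓ} → Π-type T → Π-type (tailᵀ T)
tail α n = α (suc n)

Π-seq : {ℓ : Level} (T : ℕ → ClosenessSpace ℓ) → Π-type T → Π-type T → ℕ → Bool
Π-seq T α β zero    = ι (proj₁ (proj₂ (T 0)) (α 0) (β 0)) 0
Π-seq T α β (suc m) = ι (proj₁ (proj₂ (T 0)) (α 0) (β 0)) (suc m)
                      ∧ Π-seq (tailᵀ T) (tail {T = T} α) (tail {T = T} β) m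

private
  ∧-true-l : {a b : Bool} → a ∧ b ≡ true → a ≡ true
  ∧-true-l {true} _ = _≡_.refl
  ∧-true-r : {a b : Bool} → a ∧ b ≡ true → b ≡ true
  ∧-true-r {true} p = p
  ∧-intro : {a b : Bool} → a ≡ true → b ≡ true → a ∧ b ≡ true
  ∧-intro _≡_.refl _≡_.refl = _≡_.refl

Π-seq-decr : {ℓ : Level} (T : ℕ → ClosenessSpace ℓ) (α β : Π-type T) → is-decreasing (Π-seq T α β)
Π-seq-decr T α β zero p =
  proj₂ (proj₁ (proj₂ (T 0)) (α 0) (β 0)) 0 (∧-true-l {b = Π-seq (tailᵀ T) (tail {T = T} α) (tail {T = T} β) 0} p)
Π-seq-decr T α β (suc m) p =
  ∧-intro (proj₂ (proj₁ (proj₂ (T 0)) (α 0) (β 0)) (suc m) (∧-true-l {b = Π-seq (tailᵀ T) (tail {T = T} α) (tail {T = T} β) (suc m)} p))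
          (Π-seq-decr (tailᵀ T) (tail {T = T} α) (tail {T = T} β) m (∧-true-r {a = ι (proj₁ (proj₂ (T 0)) (α 0) (β 0)) (suc (suc m))} p))

c-Π : {ℓ : Level} (T : ℕ → ClosenessSpace ℓ) → Π-type T → Π-type T → ℕ∞
c-Π T α β = Π-seq T α β , Π-seq-decr T α β

-- Every clause of the definition of c_{ΠT} conjoins a digit of the head closeness c₀(α₀, β₀) with
-- a digit of the closeness of the tails, so reflexivity, symmetry and the ultrametric inequality
-- hold digitwise by induction on the digit, using the corresponding axiom of each factor. For
-- c_{ΠT}(α, β) = ∞ ⇒ α = β, digit n + k of c_{ΠT}(α, β) bounds digit k of cₙ(αₙ, βₙ), so every
-- cₙ(αₙ, βₙ) is ∞; extensionality then gives α = β.
module Submission where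

open import Defs
open import Data.Nat using (ℕ; zero; suc; _+_)
open import Data.Bool using (true; _∧_)
open import Data.Bool.Properties using (_≟_; ∧-conicalˡ; ∧-conicalʳ)
open import Data.Product using (_,_; proj₁; proj₂)
open import Relation.Binary.PropositionalEquality using (_≡_; refl; cong; cong₂)
open import Function.Bundles using (mk⇔; Equivalence)
open import Level using (Level)
open import Axiom.Extensionality.Propositional using (Extensionality; lower-extensionality)
open import Axiom.UniquenessOfIdentityProofs using (module Decidable⇒UIP)

ℕ∞-≡ : Extensionality Level.zero Level.zero →
       {u v : ℕ∞} → (∀ n → ι u n ≡ ι v n) → u ≡ v
ℕ∞-≡ ext {u , du} {v , dv} u≗v with ext u≗v
... | refl = cong (u ,_) (ext λ n → ext λ _ → Decidable⇒UIP.≡-irrelevant _≟_ _ _)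

≡∞⇒ι≡true : {u : ℕ∞} → u ≡ ∞ → ∀ n → ι u n ≡ true
≡∞⇒ι≡true u≡∞ n = cong (λ u → ι u n) u≡∞

module _ {ℓ : Level} {X : Set ℓ} {c : X → X → ℕ∞} (isC : IsClosenessSpace X c) where
  open IsClosenessSpace isC

  c-self-ι : ∀ x n → ι (c x x) n ≡ true
  c-self-ι x = ≡∞⇒ι≡true (Equivalence.from (c-∞ x x) refl)

  c-sym-ι : ∀ x y n → ι (c x y) n ≡ ι (c y x) n
  c-sym-ι x y n = cong (λ u → ι u n) (c-sym x y)

  c-ultra-ι : ∀ x y z n → ι (c x y) n ≡ true → ι (c y z) n ≡ true → ι (c x z) n ≡ true
  c-ultra-ι x y z n p q = c-ultra x y z n (cong₂ _∧_ p q)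

closenessᵀ : {ℓ : Level} (T : ℕ → ClosenessSpace ℓ) (n : ℕ) →
             proj₁ (T n) → proj₁ (T n) → ℕ∞
closenessᵀ T n = proj₁ (proj₂ (T n))

isClosenessᵀ : {ℓ : Level} (T : ℕ → ClosenessSpace ℓ) (n : ℕ) →
               IsClosenessSpace (proj₁ (T n)) (closenessᵀ T n)
isClosenessᵀ T n = proj₂ (proj₂ (T n))

module _ {ℓ : Level} where

  Π-seq-self : (T : ℕ → ClosenessSpace ℓ) (α : Π-type T) (m : ℕ) → Π-seq T α α m ≡ true
  Π-seq-self T α zero    = c-self-ι (isClosenessᵀ T 0) (α 0) 0
  Π-seq-self T α (suc m) =
    cong₂ _∧_ (c-self-ι (isClosenessᵀ T 0) (α 0) (suc m)) (Π-seq-self (tailᵀ T) (tail {T = T} α) m)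

  Π-seq-sym : (T : ℕ → ClosenessSpace ℓ) (α β : Π-type T) (m : ℕ) →
              Π-seq T α β m ≡ Π-seq T β α m
  Π-seq-sym T α β zero    = c-sym-ι (isClosenessᵀ T 0) (α 0) (β 0) 0
  Π-seq-sym T α β (suc m) =
    cong₂ _∧_ (c-sym-ι (isClosenessᵀ T 0) (α 0) (β 0) (suc m))
              (Π-seq-sym (tailᵀ T) (tail {T = T} α) (tail {T = T} β) m)

  Π-seq-ultra : (T : ℕ → ClosenessSpace ℓ) (α β γ : Π-type T) (m : ℕ) →
                Π-seq T α β m ≡ true → Π-seq T β γ m ≡ true → Π-seq T α γ m ≡ true
  Π-seq-ultra T α β γ zero = c-ultra-ι (isClosenessᵀ T 0) (α 0) (β 0) (γ 0) 0
  Π-seq-ultra T α β γ (suc m) p q =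
    cong₂ _∧_ (c-ultra-ι (isClosenessᵀ T 0) (α 0) (β 0) (γ 0) (suc m)
                 (∧-conicalˡ _ _ p) (∧-conicalˡ _ _ q))
              (Π-seq-ultra (tailᵀ T) (tail {T = T} α) (tail {T = T} β) (tail {T = T} γ) m
                 (∧-conicalʳ _ _ p) (∧-conicalʳ _ _ q))

  Π-seq⇒closenessᵀ : (T : ℕ → ClosenessSpace ℓ) (α β : Π-type T) (n k : ℕ) →
                     Π-seq T α β (n + k) ≡ true → ι (closenessᵀ T n (α n) (β n)) k ≡ true
  Π-seq⇒closenessᵀ T α β zero    zero    p = p
  Π-seq⇒closenessᵀ T α β zero    (suc k) p = ∧-conicalˡ _ _ p
  Π-seq⇒closenessᵀ T α β (suc n) k       p =
    Π-seq⇒closenessᵀ (tailᵀ T) (tail {T = T} α) (tail {T = T} β) n k (∧-conicalʳ _ _ p)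

lemma3p76 : {ℓ : Level} → Extensionality Level.zero ℓ →
              (T : ℕ → ClosenessSpace ℓ) → IsClosenessSpace (Π-type T) (c-Π T)
lemma3p76 {ℓ} ext T = record
  { c-∞     = λ α β → mk⇔ (≡∞⇒≡ α β) (≡⇒≡∞ α β)
  ; c-sym   = λ α β → ℕ∞-≡ ext₀ (Π-seq-sym T α β)
  ; c-ultra = λ α β γ n p → Π-seq-ultra T α β γ n (∧-conicalˡ _ _ p) (∧-conicalʳ _ _ p)
  }
  where
  ext₀ : Extensionality Level.zero Level.zero
  ext₀ = lower-extensionality Level.zero ℓ ext

  ≡∞⇒≡ : (α β : Π-type T) → c-Π T α β ≡ ∞ → α ≡ β
  ≡∞⇒≡ α β e = ext λ n → Equivalence.to (IsClosenessSpace.c-∞ (isClosenessᵀ T n) (α n) (β n))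
    (ℕ∞-≡ ext₀ λ k → Π-seq⇒closenessᵀ T α β n k (≡∞⇒ι≡true e (n + k)))

  ≡⇒≡∞ : (α β : Π-type T) → α ≡ β → c-Π T α β ≡ ∞
  ≡⇒≡∞ α .α refl = ℕ∞-≡ ext₀ (Π-seq-self T α)
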